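{- If a quiver $Q$ does not have a rank function, then $\dim(\operatorname{DE}(Q))\ge c(Q)$, where $c(Q)=\#Q_0-\#\pi_0(Q)$.
   Context: A quiver is a pair $Q=(Q_0,Q_1)$ with $Q_0$ finite and $Q_1\subset (Q_0\times Q_0)\setminus\{(v,v)\}$. $\varepsilon_{(v,w)}=\kappa_{\{v\}}-\kappa_{\{w\}}\in\mathbb{R}^{Q_0}$ with $\kappa_{\{v\}}$ the indicator of $v$; $\operatorname{DE}(Q)=\operatorname{conv}\{\varepsilon_{(v,w)}\mid(v,w)\in Q_1\}$. $\pi_0(Q)$ is the set of connected components (connectivity via undirected walks). A rank function of $Q$ is $\rho:Q_0\to\mathbb{R}$ with $\rho(v)+1=\rho(w)$ for each $(v,w)\in Q_1$. -}

module Defs where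

open import Data.Nat using (ℕ; zero; suc; _∸_)
open import Data.Fin using (Fin; zero; suc)
open import Data.Fin.Properties using (_≟_)
open import Data.Rational using (ℚ; 0ℚ; 1ℚ; _+_; _*_; _-_; _≤_)
open import Data.List using (List; length; lookup)
open import Data.List.Membership.Propositional using (_∈_)
open import Data.List.Relation.Unary.All using (All)
open import Data.Product using (Σ; ∃; _×_; _,_; proj₁; proj₂)
open import Data.Bool using (if_then_else_)
open import Relation.Nullary using (¬_)
open import Relation.Nullary.Decidable using (⌊_⌋)
open import Relation.Binary.PropositionalEquality using (_≡_; _≢_)

record Quiver : Set where
  field
    n       : ℕ
    arrows  : List (Fin n × Fin n)
    noLoops : All (λ a → proj₁ a ≢ proj₂ a) arrows

open Quiver public

Pt : ℕ → Set
Pt n = Fin n → ℚ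

∑ : {k : ℕ} → (Fin k → ℚ) → ℚ
∑ {zero}  f = 0ℚ
∑ {suc k} f = f zero + ∑ (λ i → f (suc i))

κ : {n : ℕ} → Fin n → Pt n
κ v u = if ⌊ v ≟ u ⌋ then 1ℚ else 0ℚ

ε : {n : ℕ} → Fin n × Fin n → Pt n
ε (v , w) u = κ v u - κ w u

InDE : (Q : Quiver) → Pt (n Q) → Set
InDE Q x =
  Σ (Fin (length (arrows Q)) → ℚ) λ λs →
    (∀ i → 0ℚ ≤ λs i) ×
    (∑ λs ≡ 1ℚ) ×
    (∀ u → x u ≡ ∑ (λ i → λs i * ε (lookup (arrows Q) i) u))

AffinelyIndependent : {n d : ℕ} → (Fin (suc d) → Pt n) → Set
AffinelyIndependent {n} {d} p =
  (c : Fin d → ℚ) →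
  (∀ u → ∑ (λ i → c i * (p (suc i) u - p zero u)) ≡ 0ℚ) →
  ∀ i → c i ≡ 0ℚ

DimAtLeast : {n : ℕ} → (Pt n → Set) → ℕ → Set
DimAtLeast {n} S d =
  Σ (Fin (suc d) → Pt n) λ p → (∀ i → S (p i)) × AffinelyIndependent p

IsRankFunction : (Q : Quiver) → (Fin (n Q) → ℚ) → Set
IsRankFunction Q ρ = ∀ {v w} → (v , w) ∈ arrows Q → ρ v + 1ℚ ≡ ρ w

HasRankFunction : Quiver → Set
HasRankFunction Q = Σ (Fin (n Q) → ℚ) (IsRankFunction Q)

data Walk (Q : Quiver) : Fin (n Q) → Fin (n Q) → Set where
  here : ∀ {v} → Walk Q v v
  fwd  : ∀ {u v w} → (u , v) ∈ arrows Q → Walk Q v w → Walk Q u w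
  bwd  : ∀ {u v w} → (v , u) ∈ arrows Q → Walk Q v w → Walk Q u w

-- R : Fin k → Q₀ picks exactly one vertex from each connected component,
-- so that #π₀(Q) = k.
IsComponentTransversal : (Q : Quiver) {k : ℕ} → (Fin k → Fin (n Q)) → Set
IsComponentTransversal Q {k} R =
  (∀ v → ∃ λ i → Walk Q v (R i)) ×
  (∀ i j → Walk Q (R i) (R j) → i ≡ j)

-- A potential ρ : Q₀ → ℚ pairs with ε_(v,w) to ρ v − ρ w, so every affine
-- dependence among points ε_a yields, for each ρ, the same dependence among
-- the differences of ρ along the arrows a. Growing a spanning forest from
-- the component representatives gives n − k arrows along which these
-- differences can be prescribed at will. Prescribing −1 gives a potential
-- which, as Q has no rank function, fails at some arrow a. Pairing a
-- dependence of ε_a and the forest points with that potential forces the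
-- coefficients to sum to 0; pairing it with the potential whose differences
-- are 1 on a single forest arrow j and 0 on the others then gives c_j = 0.
module Submission where

open import Defs
open import Data.Nat as ℕ using (ℕ; zero; suc; _∸_)
import Data.Nat.Properties as ℕ
open import Data.Fin using (Fin; zero; suc)
open import Data.Fin.Properties using (_≟_; pigeonhole; <⇒≢)
open import Data.Rational using (ℚ; 0ℚ; 1ℚ; _+_; _*_; _-_; -_; 1/_; _≤_; ≢-nonZero)
import Data.Rational.Properties as ℚ
open import Data.Rational.Solver using (module +-*-Solver)
open import Algebra.Bundles using (CommutativeRing)
open import Algebra.Properties.Semiring.Sum (CommutativeRing.semiring ℚ.+-*-commutativeRing)
  using (sum; sum-cong-≗; ∑-comm; *-distribˡ-sum; *-distribʳ-sum; sum-replicate-zero)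
open import Algebra.Properties.Group (CommutativeRing.+-group ℚ.+-*-commutativeRing)
  using (x∙y⁻¹≈ε⇒x≈y)
open import Algebra.Properties.CommutativeSemigroup
  (CommutativeRing.*-commutativeSemigroup ℚ.+-*-commutativeRing) using (x∙yz≈y∙xz)
import Data.Vec.Functional as Vector
open import Data.Vec.Functional using (updateAt)
open import Data.Vec.Functional.Properties using (updateAt-updates; updateAt-minimal)
open import Data.List using (List; _∷_; length; lookup; tabulate)
open import Data.List.Properties using (length-tabulate)
open import Data.List.Membership.Propositional using (_∈_; _∉_; find)
open import Data.List.Membership.Propositional.Properties using (∈-tabulate⁺)
import Data.List.Membership.DecPropositional as DecMembership
open import Data.List.Relation.Unary.Any using (Any; here; there; index; any?)
open import Data.List.Relation.Unary.Any.Properties using (lookup-index)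
import Data.List.Relation.Unary.All as All
open import Data.List.Relation.Unary.All.Properties using (¬Any⇒All¬; ¬All⇒Any¬)
open import Data.Product using (Σ; ∃; _×_; _,_; proj₁; proj₂)
import Data.Product as Product
open import Data.Sum using (_⊎_; inj₁; inj₂)
open import Data.Empty using (⊥-elim)
open import Function using (_∘_; id; const)
open import Relation.Nullary using (¬_; Dec; yes; no)
open import Relation.Nullary.Decidable using (_×-dec_; _⊎-dec_; ¬?; decidable-stable)
open import Relation.Binary.PropositionalEquality
open +-*-Solver

∑≗sum : ∀ {k} (f : Fin k → ℚ) → ∑ f ≡ sum f
∑≗sum {zero}  f = refl
∑≗sum {suc k} f = cong (f zero +_) (∑≗sum (f ∘ suc))

sum-distrib-− : ∀ {k} (f g : Fin k → ℚ) → sum (λ i → f i - g i) ≡ sum f - sum g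
sum-distrib-− {zero}  f g = refl
sum-distrib-− {suc k} f g = begin
  (f zero - g zero) + sum (λ i → f (suc i) - g (suc i))
    ≡⟨ cong ((f zero - g zero) +_) (sum-distrib-− (f ∘ suc) (g ∘ suc)) ⟩
  (f zero - g zero) + (sum (f ∘ suc) - sum (g ∘ suc))
    ≡⟨ solve 4 (λ a b c d → (a :- c) :+ (b :- d) := (a :+ b) :- (c :+ d)) refl
               (f zero) (sum (f ∘ suc)) (g zero) (sum (g ∘ suc)) ⟩
  (f zero + sum (f ∘ suc)) - (g zero + sum (g ∘ suc)) ∎
  where open ≡-Reasoning

*-distribˡ-− : ∀ p q r → p * (q - r) ≡ p * q - p * r
*-distribˡ-− = solve 3 (λ p q r → p :* (q :- r) := p :* q :- p :* r) refl

κ-suc : ∀ {k} (e i : Fin k) → κ (suc e) (suc i) ≡ κ e i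
κ-suc e i with e ≟ i
... | yes _ = refl
... | no  _ = refl

sum-*-κ : ∀ {k} (f : Fin k → ℚ) (e : Fin k) → sum (λ i → f i * κ e i) ≡ f e
sum-*-κ {suc k} f zero = begin
  f zero * 1ℚ + sum (λ i → f (suc i) * 0ℚ) ≡⟨ cong₂ _+_ (ℚ.*-identityʳ (f zero))
                                                      (sum-cong-≗ (ℚ.*-zeroʳ ∘ f ∘ suc)) ⟩
  f zero + sum {k} (const 0ℚ)               ≡⟨ cong (f zero +_) (sum-replicate-zero k) ⟩
  f zero + 0ℚ                               ≡⟨ ℚ.+-identityʳ (f zero) ⟩
  f zero                                    ∎
  where open ≡-Reasoning
sum-*-κ {suc k} f (suc e) = begin
  f zero * 0ℚ + sum (λ i → f (suc i) * κ (suc e) (suc i))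
    ≡⟨ cong₂ _+_ (ℚ.*-zeroʳ (f zero)) (sum-cong-≗ (λ i → cong (f (suc i) *_) (κ-suc e i))) ⟩
  0ℚ + sum (λ i → f (suc i) * κ e i)          ≡⟨ ℚ.+-identityˡ _ ⟩
  sum (λ i → f (suc i) * κ e i)               ≡⟨ sum-*-κ (f ∘ suc) e ⟩
  f (suc e)                                   ∎
  where open ≡-Reasoning

p*q≡0⇒p≡0 : ∀ {p q} → q ≢ 0ℚ → p * q ≡ 0ℚ → p ≡ 0ℚ
p*q≡0⇒p≡0 {p} {q} q≢0 pq≡0 = begin
  p                ≡⟨ sym (ℚ.*-identityʳ p) ⟩
  p * 1ℚ           ≡⟨ cong (p *_) (sym (ℚ.*-inverseʳ q)) ⟩
  p * (q * (1/ q)) ≡⟨ sym (ℚ.*-assoc p q (1/ q)) ⟩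
  (p * q) * (1/ q) ≡⟨ cong (_* (1/ q)) pq≡0 ⟩
  0ℚ * (1/ q)      ≡⟨ ℚ.*-zeroˡ (1/ q) ⟩
  0ℚ               ∎
  where open ≡-Reasoning
        instance _ = ≢-nonZero q≢0

⟨_,_⟩ : ∀ {n} → Pt n → Pt n → ℚ
⟨ ρ , x ⟩ = sum (λ u → ρ u * x u)

⟨⟩-distrib-− : ∀ {n} (ρ x y : Pt n) → ⟨ ρ , (λ u → x u - y u) ⟩ ≡ ⟨ ρ , x ⟩ - ⟨ ρ , y ⟩
⟨⟩-distrib-− ρ x y = trans (sum-cong-≗ (λ u → *-distribˡ-− (ρ u) (x u) (y u)))
                           (sum-distrib-− (λ u → ρ u * x u) (λ u → ρ u * y u))

⟨⟩-linear : ∀ {n d} (ρ : Pt n) (c : Fin d → ℚ) (y : Fin d → Pt n) →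
            sum (λ i → c i * ⟨ ρ , y i ⟩) ≡ ⟨ ρ , (λ u → sum (λ i → c i * y i u)) ⟩
⟨⟩-linear ρ c y = begin
  sum (λ i → c i * sum (λ u → ρ u * y i u))
    ≡⟨ sum-cong-≗ (λ i → *-distribˡ-sum (c i) (λ u → ρ u * y i u)) ⟩
  sum (λ i → sum (λ u → c i * (ρ u * y i u)))
    ≡⟨ ∑-comm (λ i u → c i * (ρ u * y i u)) ⟩
  sum (λ u → sum (λ i → c i * (ρ u * y i u)))
    ≡⟨ sum-cong-≗ (λ u → sum-cong-≗ (λ i → x∙yz≈y∙xz (c i) (ρ u) (y i u))) ⟩
  sum (λ u → sum (λ i → ρ u * (c i * y i u)))
    ≡⟨ sum-cong-≗ (λ u → sym (*-distribˡ-sum (ρ u) (λ i → c i * y i u))) ⟩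
  sum (λ u → ρ u * sum (λ i → c i * y i u)) ∎
  where open ≡-Reasoning

⟨⟩-vanishes : ∀ {n} (ρ x : Pt n) → (∀ u → x u ≡ 0ℚ) → ⟨ ρ , x ⟩ ≡ 0ℚ
⟨⟩-vanishes {n} ρ x x≡0 =
  trans (sum-cong-≗ (λ u → trans (cong (ρ u *_) (x≡0 u)) (ℚ.*-zeroʳ (ρ u)))) (sum-replicate-zero n)

Δ : ∀ {n} → Pt n → Fin n × Fin n → ℚ
Δ ρ (v , w) = ρ v - ρ w

⟨⟩-ε : ∀ {n} (ρ : Pt n) (a : Fin n × Fin n) → ⟨ ρ , ε a ⟩ ≡ Δ ρ a
⟨⟩-ε ρ (v , w) = trans (⟨⟩-distrib-− ρ (κ v) (κ w)) (cong₂ _-_ (sum-*-κ ρ v) (sum-*-κ ρ w))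

Δ-dependence : ∀ {n d} (c : Fin d → ℚ) (P : Fin d → Fin n × Fin n) (a : Fin n × Fin n) →
               (∀ u → ∑ (λ i → c i * (ε (P i) u - ε a u)) ≡ 0ℚ) →
               ∀ ρ → sum (λ i → c i * (Δ ρ (P i) - Δ ρ a)) ≡ 0ℚ
Δ-dependence c P a dependent ρ = begin
  sum (λ i → c i * (Δ ρ (P i) - Δ ρ a))
    ≡⟨ sum-cong-≗ (λ i → cong (c i *_) (sym (⟨⟩-ε-− i))) ⟩
  sum (λ i → c i * ⟨ ρ , (λ u → ε (P i) u - ε a u) ⟩)
    ≡⟨ ⟨⟩-linear ρ c (λ i u → ε (P i) u - ε a u) ⟩
  ⟨ ρ , (λ u → sum (λ i → c i * (ε (P i) u - ε a u))) ⟩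
    ≡⟨ ⟨⟩-vanishes ρ _ (λ u → trans (sym (∑≗sum (λ i → c i * (ε (P i) u - ε a u)))) (dependent u)) ⟩
  0ℚ ∎
  where
  open ≡-Reasoning
  ⟨⟩-ε-− : ∀ i → ⟨ ρ , (λ u → ε (P i) u - ε a u) ⟩ ≡ Δ ρ (P i) - Δ ρ a
  ⟨⟩-ε-− i = trans (⟨⟩-distrib-− ρ (ε (P i)) (ε a)) (cong₂ _-_ (⟨⟩-ε ρ (P i)) (⟨⟩-ε ρ a))

sum-*-shift : ∀ {d} (c t : Fin d → ℚ) (r : ℚ) →
              sum (λ i → c i * (t i - r)) ≡ sum (λ i → c i * t i) - sum c * r
sum-*-shift c t r = begin
  sum (λ i → c i * (t i - r))
    ≡⟨ sum-cong-≗ (λ i → *-distribˡ-− (c i) (t i) r) ⟩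
  sum (λ i → c i * t i - c i * r)
    ≡⟨ sum-distrib-− (λ i → c i * t i) (λ i → c i * r) ⟩
  sum (λ i → c i * t i) - sum (λ i → c i * r)
    ≡⟨ cong (λ z → sum (λ i → c i * t i) - z) (sym (*-distribʳ-sum r c)) ⟩
  sum (λ i → c i * t i) - sum c * r ∎
  where open ≡-Reasoning

-- The arrows P j impose independent linear conditions on potentials; for
-- arrows of a quiver this says exactly that they form a forest.
Solvable : ∀ {n m} → (Fin m → Fin n × Fin n) → Set
Solvable {n} {m} P = (t : Fin m → ℚ) → Σ (Pt n) λ ρ → ∀ j → Δ ρ (P j) ≡ t j

ε-affinelyIndependent : ∀ {n d} (a : Fin n × Fin n) (P : Fin d → Fin n × Fin n) → Solvable P →
                        (ρ : Pt n) (s : ℚ) → (∀ j → Δ ρ (P j) ≡ s) → Δ ρ a ≢ s →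
                        AffinelyIndependent (ε a Vector.∷ ε ∘ P)
ε-affinelyIndependent a P solvable ρ s ρ-constant a-differs c dependent j = begin
  c j                                     ≡⟨ sym (sum-*-κ c j) ⟩
  sum (λ i → c i * κ j i)                 ≡⟨ sym (ℚ.+-identityʳ _) ⟩
  sum (λ i → c i * κ j i) - 0ℚ            ≡⟨ cong (λ z → sum (λ i → c i * κ j i) - z) (sym ∑c*Δσa≡0) ⟩
  sum (λ i → c i * κ j i) - sum c * Δ σ a ≡⟨ sym (sum-*-shift c (κ j) (Δ σ a)) ⟩
  sum (λ i → c i * (κ j i - Δ σ a))       ≡⟨ sum-cong-≗ (λ i → cong (λ z → c i * (z - Δ σ a)) (sym (σ-solves i))) ⟩
  sum (λ i → c i * (Δ σ (P i) - Δ σ a))   ≡⟨ Δ-dependence c P a dependent σ ⟩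
  0ℚ                                      ∎
  where
  open ≡-Reasoning
  ∑c≡0 : sum c ≡ 0ℚ
  ∑c≡0 = p*q≡0⇒p≡0 (a-differs ∘ sym ∘ x∙y⁻¹≈ε⇒x≈y s (Δ ρ a)) (begin
    sum c * (s - Δ ρ a)                   ≡⟨ *-distribʳ-sum (s - Δ ρ a) c ⟩
    sum (λ i → c i * (s - Δ ρ a))         ≡⟨ sum-cong-≗ (λ i → cong (λ z → c i * (z - Δ ρ a)) (sym (ρ-constant i))) ⟩
    sum (λ i → c i * (Δ ρ (P i) - Δ ρ a)) ≡⟨ Δ-dependence c P a dependent ρ ⟩
    0ℚ                                    ∎)
  σ : Pt _
  σ = proj₁ (solvable (κ j))
  σ-solves : ∀ i → Δ σ (P i) ≡ κ j i
  σ-solves = proj₂ (solvable (κ j))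
  ∑c*Δσa≡0 : sum c * Δ σ a ≡ 0ℚ
  ∑c*Δσa≡0 = trans (cong (_* Δ σ a) ∑c≡0) (ℚ.*-zeroˡ (Δ σ a))

_∉ends_ : ∀ {n} → Fin n → Fin n × Fin n → Set
x ∉ends (v , w) = v ≢ x × w ≢ x

Δ-updateAt : ∀ {n} (ρ : Pt n) x r a → x ∉ends a → Δ (updateAt ρ x (const r)) a ≡ Δ ρ a
Δ-updateAt ρ x r (v , w) (v≢x , w≢x) = cong₂ _-_ (updateAt-minimal v x ρ v≢x) (updateAt-minimal w x ρ w≢x)

module _ {n m} {P : Fin m → Fin n × Fin n} (solvable : Solvable P) {x : Fin n}
         (fresh : ∀ j → x ∉ends P j) {y : Fin n} (y≢x : y ≢ x) where

  solvable-∷-into : Solvable ((y , x) Vector.∷ P)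
  solvable-∷-into t = ρ′ , λ where
      zero → begin
        ρ′ y - ρ′ x          ≡⟨ cong₂ _-_ (updateAt-minimal y x ρ y≢x) (updateAt-updates x ρ) ⟩
        ρ y - (ρ y - t zero) ≡⟨ solve 2 (λ a b → a :- (a :- b) := b) refl (ρ y) (t zero) ⟩
        t zero               ∎
      (suc j) → trans (Δ-updateAt ρ x _ (P j) (fresh j)) (proj₂ (solvable (Vector.tail t)) j)
    where
    open ≡-Reasoning
    ρ ρ′ : Pt n
    ρ  = proj₁ (solvable (Vector.tail t))
    ρ′ = updateAt ρ x (const (ρ y - t zero))

  solvable-∷-out : Solvable ((x , y) Vector.∷ P)
  solvable-∷-out t = ρ′ , λ where
      zero → begin
        ρ′ x - ρ′ y          ≡⟨ cong₂ _-_ (updateAt-updates x ρ) (updateAt-minimal y x ρ y≢x) ⟩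
        (ρ y + t zero) - ρ y ≡⟨ solve 2 (λ a b → (a :+ b) :- a := b) refl (ρ y) (t zero) ⟩
        t zero               ∎
      (suc j) → trans (Δ-updateAt ρ x _ (P j) (fresh j)) (proj₂ (solvable (Vector.tail t)) j)
    where
    open ≡-Reasoning
    ρ ρ′ : Pt n
    ρ  = proj₁ (solvable (Vector.tail t))
    ρ′ = updateAt ρ x (const (ρ y + t zero))

0≤κ : ∀ {n} (v u : Fin n) → 0ℚ ≤ κ v u
0≤κ v u with v ≟ u
... | yes _ = ℚ.nonNegative⁻¹ 1ℚ
... | no  _ = ℚ.≤-refl

p-q≡-1⇒p+1≡q : ∀ {p q} → p - q ≡ - 1ℚ → p + 1ℚ ≡ q
p-q≡-1⇒p+1≡q {p} {q} p-q≡-1 = begin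
  p + 1ℚ             ≡⟨ solve 2 (λ p q → p :+ con 1ℚ := q :+ ((p :- q) :+ con 1ℚ)) refl p q ⟩
  q + (p - q + 1ℚ)   ≡⟨ cong (λ z → q + (z + 1ℚ)) p-q≡-1 ⟩
  q + (- 1ℚ + 1ℚ)    ≡⟨ ℚ.+-identityʳ q ⟩
  q                  ∎
  where open ≡-Reasoning

covering⇒n≤length : ∀ {n} (xs : List (Fin n)) → (∀ v → v ∈ xs) → n ℕ.≤ length xs
covering⇒n≤length xs covers = ℕ.≮⇒≥ λ |xs|<n →
  let i , j , i<j , same-position = pigeonhole |xs|<n (λ v → index (covers v))
  in <⇒≢ i<j (begin
       i                          ≡⟨ lookup-index (covers i) ⟩
       lookup xs (index (covers i)) ≡⟨ cong (lookup xs) same-position ⟩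
       lookup xs (index (covers j)) ≡⟨ sym (lookup-index (covers j)) ⟩
       j                          ∎)
  where open ≡-Reasoning

module _ (Q : Quiver) where
  open DecMembership (_≟_ {n Q}) using (_∈?_)

  module _ (S : Fin (n Q) → Set)
           (forward  : ∀ {v w} → (v , w) ∈ arrows Q → S v → S w)
           (backward : ∀ {v w} → (v , w) ∈ arrows Q → S w → S v) where

    arrow-closed⇒walk-closed : ∀ {a b} → Walk Q a b → S b → S a
    arrow-closed⇒walk-closed here      = id
    arrow-closed⇒walk-closed (fwd p w) = backward p ∘ arrow-closed⇒walk-closed w
    arrow-closed⇒walk-closed (bwd p w) = forward p ∘ arrow-closed⇒walk-closed w

  Crosses : List (Fin (n Q)) → Fin (n Q) × Fin (n Q) → Set
  Crosses S (v , w) = (v ∈ S × w ∉ S) ⊎ (w ∈ S × v ∉ S)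

  crosses? : ∀ S a → Dec (Crosses S a)
  crosses? S (v , w) = ((v ∈? S) ×-dec ¬? (w ∈? S)) ⊎-dec ((w ∈? S) ×-dec ¬? (v ∈? S))

  ε∈DE : ∀ {a} → a ∈ arrows Q → InDE Q (ε a)
  ε∈DE {a} a∈Q₁ = κ i , 0≤κ i , weights-sum , coordinates
    where
    open ≡-Reasoning
    i : Fin (length (arrows Q))
    i = index a∈Q₁
    weights-sum : ∑ (κ i) ≡ 1ℚ
    weights-sum = begin
      ∑ (κ i)                 ≡⟨ ∑≗sum (κ i) ⟩
      sum (κ i)               ≡⟨ sum-cong-≗ (λ j → sym (ℚ.*-identityˡ (κ i j))) ⟩
      sum (λ j → 1ℚ * κ i j)  ≡⟨ sum-*-κ (const 1ℚ) i ⟩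
      1ℚ                      ∎
    coordinates : ∀ u → ε a u ≡ ∑ (λ j → κ i j * ε (lookup (arrows Q) j) u)
    coordinates u = sym (begin
      ∑ (λ j → κ i j * ε (lookup (arrows Q) j) u)   ≡⟨ ∑≗sum (λ j → κ i j * ε (lookup (arrows Q) j) u) ⟩
      sum (λ j → κ i j * ε (lookup (arrows Q) j) u) ≡⟨ sum-cong-≗ (λ j → ℚ.*-comm (κ i j) _) ⟩
      sum (λ j → ε (lookup (arrows Q) j) u * κ i j) ≡⟨ sum-*-κ (λ j → ε (lookup (arrows Q) j) u) i ⟩
      ε (lookup (arrows Q) i) u                     ≡⟨ cong (λ b → ε b u) (sym (lookup-index a∈Q₁)) ⟩
      ε a u                                         ∎)

  rank-violation : ¬ HasRankFunction Q → ∀ ρ → ∃ λ a → a ∈ arrows Q × Δ ρ a ≢ - 1ℚ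
  rank-violation no-rank ρ = find (¬All⇒Any¬ (λ a → Δ ρ a ℚ.≟ - 1ℚ) (arrows Q) λ Δ≡-1 →
    no-rank (ρ , λ {v} a∈Q₁ → p-q≡-1⇒p+1≡q {ρ v} (All.lookup Δ≡-1 a∈Q₁)))

  module _ {k} (R : Fin k → Fin (n Q)) where

    record RootedForest (m : ℕ) : Set where
      field
        vertices : List (Fin (n Q))
        edge     : Fin m → Fin (n Q) × Fin (n Q)
        edge∈Q₁  : ∀ j → edge j ∈ arrows Q
        size     : length vertices ≡ k ℕ.+ m
        roots⊆   : ∀ i → R i ∈ vertices
        edges⊆   : ∀ j → proj₁ (edge j) ∈ vertices × proj₂ (edge j) ∈ vertices
        solvable : Solvable edge

    open RootedForest

    roots : RootedForest 0
    roots = record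
      { vertices = tabulate R
      ; edge     = λ ()
      ; edge∈Q₁  = λ ()
      ; size     = trans (length-tabulate R) (sym (ℕ.+-identityʳ k))
      ; roots⊆   = ∈-tabulate⁺
      ; edges⊆   = λ ()
      ; solvable = λ _ → const 0ℚ , λ ()
      }

    attach : ∀ {m} (F : RootedForest m) (x : Fin (n Q)) (b : Fin (n Q) × Fin (n Q)) →
             b ∈ arrows Q → proj₁ b ∈ x ∷ vertices F → proj₂ b ∈ x ∷ vertices F →
             Solvable (b Vector.∷ edge F) → RootedForest (suc m)
    attach {m} F x b b∈Q₁ b₁∈ b₂∈ b∷F-solvable = record
      { vertices = x ∷ vertices F
      ; edge     = b Vector.∷ edge F
      ; edge∈Q₁  = λ { zero → b∈Q₁ ; (suc j) → edge∈Q₁ F j }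
      ; size     = trans (cong suc (size F)) (sym (ℕ.+-suc k m))
      ; roots⊆   = there ∘ roots⊆ F
      ; edges⊆   = λ { zero → b₁∈ , b₂∈ ; (suc j) → Product.map there there (edges⊆ F j) }
      ; solvable = b∷F-solvable
      }

    ∈∧∉⇒≢ : ∀ {u x} {S : List (Fin (n Q))} → u ∈ S → x ∉ S → u ≢ x
    ∈∧∉⇒≢ u∈ x∉ refl = x∉ u∈

    fresh : ∀ {m} (F : RootedForest m) {x} → x ∉ vertices F → ∀ j → x ∉ends edge F j
    fresh F x∉ j = ∈∧∉⇒≢ (proj₁ (edges⊆ F j)) x∉ , ∈∧∉⇒≢ (proj₂ (edges⊆ F j)) x∉

    grow : ∀ {m a} (F : RootedForest m) → a ∈ arrows Q → Crosses (vertices F) a → RootedForest (suc m)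
    grow {a = v , w} F a∈Q₁ (inj₁ (v∈ , w∉)) =
      attach F w (v , w) a∈Q₁ (there v∈) (here refl)
             (solvable-∷-into (solvable F) (fresh F w∉) (∈∧∉⇒≢ v∈ w∉))
    grow {a = v , w} F a∈Q₁ (inj₂ (w∈ , v∉)) =
      attach F v (v , w) a∈Q₁ (here refl) (there w∈)
             (solvable-∷-out (solvable F) (fresh F v∉) (∈∧∉⇒≢ w∈ v∉))

    module _ (reach : ∀ v → ∃ λ i → Walk Q v (R i)) where

      saturated : ∀ {m} (F : RootedForest m) → ¬ Any (Crosses (vertices F)) (arrows Q) →
                  ∀ v → v ∈ vertices F
      saturated F no-crossing v = arrow-closed⇒walk-closed (_∈ vertices F) forward backward
                                    (proj₂ (reach v)) (roots⊆ F (proj₁ (reach v)))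
        where
        stuck : ∀ {a} → a ∈ arrows Q → ¬ Crosses (vertices F) a
        stuck = All.lookup (¬Any⇒All¬ (arrows Q) no-crossing)
        forward : ∀ {v w} → (v , w) ∈ arrows Q → v ∈ vertices F → w ∈ vertices F
        forward a∈Q₁ v∈ = decidable-stable (_ ∈? vertices F) (λ w∉ → stuck a∈Q₁ (inj₁ (v∈ , w∉)))
        backward : ∀ {v w} → (v , w) ∈ arrows Q → w ∈ vertices F → v ∈ vertices F
        backward a∈Q₁ w∈ = decidable-stable (_ ∈? vertices F) (λ v∉ → stuck a∈Q₁ (inj₂ (w∈ , v∉)))

      spanningForest : ∀ m → m ℕ.≤ n Q ∸ k → RootedForest m
      spanningForest zero    _        = roots
      spanningForest (suc m) m<n∸k
        with F ← spanningForest m (ℕ.<⇒≤ m<n∸k) | any? (crosses? (vertices F)) (arrows Q)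
      ... | yes crossing = let _ , a∈Q₁ , a-crosses = find crossing in grow F a∈Q₁ a-crosses
      ... | no  no-crossing = ⊥-elim (ℕ.<⇒≱ m<n∸k n∸k≤m)
        where
        n≤k+m : n Q ℕ.≤ k ℕ.+ m
        n≤k+m = subst (n Q ℕ.≤_) (size F) (covering⇒n≤length (vertices F) (saturated F no-crossing))
        n∸k≤m : n Q ∸ k ℕ.≤ m
        n∸k≤m = subst (n Q ∸ k ℕ.≤_) (ℕ.m+n∸m≡n k m) (ℕ.∸-monoˡ-≤ k n≤k+m)

lemma3p11 : (Q : Quiver) → ¬ HasRankFunction Q →
    (k : ℕ) (R : Fin k → Fin (n Q)) → IsComponentTransversal Q R →
    DimAtLeast (InDE Q) (n Q ∸ k)
lemma3p11 Q no-rank k R (reach , _) =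
  let open RootedForest (spanningForest Q R reach (n Q ∸ k) ℕ.≤-refl)
      ρ , ρ-descends        = solvable (const (- 1ℚ))
      a , a∈Q₁ , a-violates = rank-violation Q no-rank ρ
  in  ε a Vector.∷ ε ∘ edge ,
      (λ { zero → ε∈DE Q a∈Q₁ ; (suc j) → ε∈DE Q (edge∈Q₁ j) }) ,
      ε-affinelyIndependent a edge solvable ρ (- 1ℚ) ρ-descends a-violates
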